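{- Let $\varrho$ be a depth measure on $\mathbb{R}^d$ satisfying non-triviality and super-additivity. Then for all finite $S\subset\mathbb{R}^d$ and $q\in\mathbb{R}^d$, $\varrho(S,q)\geq\mathrm{TvD}(S,q)$.
   Context: A depth measure assigns to each finite $S\subset\mathbb{R}^d$ and $q\in\mathbb{R}^d$ a value $\varrho(S,q)\geq 0$. Non-triviality: $\varrho(S,q)\geq 1$ whenever $q\in\mathrm{conv}(S)$. Super-additivity: for any finite $S$, disjoint subsets $S_1,S_2\subseteq S$ and $q$, $\varrho(S,q)\geq\varrho(S_1,q)+\varrho(S_2,q)$. An $r$-partition of $S$ is a partition into $r$ pairwise disjoint sets $S_1,\dots,S_r$ with $\bigcap_i\mathrm{conv}(S_i)\neq\emptyset$; the Tverberg depth $\mathrm{TvD}(S,q)$ is the maximum $r$ such that there is an $r$-partition of $S$ with $q\in\bigcap_i\mathrm{conv}(S_i)$ (and $0$ if there is none). -}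

module Defs where

open import Level using (0ℓ)
open import Data.Nat using (ℕ; zero; suc)
open import Data.Fin using (Fin)
open import Data.Vec using (Vec; replicate; zipWith; map)
open import Data.List using (List; []; _∷_)
open import Data.List.Membership.Propositional using (_∈_)
open import Data.Product using (Σ; _×_; _,_; ∃)
open import Data.Empty using (⊥)
open import Data.Sum using (_⊎_)
open import Relation.Nullary using (¬_)
open import Relation.Binary.PropositionalEquality using (_≡_)
open import Relation.Binary.Structures using (IsTotalOrder)
open import Function.Bundles using (_⇔_)
import Algebra.Structures as AS

-- An ordered field (with propositional equality).  ℝ is an instance;
-- the theorem is stated for an arbitrary ordered field 𝔽, which in
-- particular covers 𝔽 = ℝ (agda-stdlib has no real numbers).
record OrderedField : Set₁ where
  infixl 6 _+_
  infixl 7 _*_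
  infix 4 _≤_
  field
    Carrier : Set
    _+_ _*_ : Carrier → Carrier → Carrier
    -_      : Carrier → Carrier
    0# 1#   : Carrier
    _≤_     : Carrier → Carrier → Set
    isCommutativeRing : AS.IsCommutativeRing {A = Carrier} _≡_ _+_ _*_ -_ 0# 1#
    0≢1     : ¬ (0# ≡ 1#)
    inverse : ∀ x → ¬ (x ≡ 0#) → ∃ λ y → x * y ≡ 1#
    isTotalOrder : IsTotalOrder _≡_ _≤_
    +-mono-≤ : ∀ {x y} z → x ≤ y → x + z ≤ y + z
    *-nonneg : ∀ {x y} → 0# ≤ x → 0# ≤ y → 0# ≤ x * y

module _ (𝔽 : OrderedField) (d : ℕ) where
  open OrderedField 𝔽

  Point : Set
  Point = Vec Carrier d

  fromℕ : ℕ → Carrier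
  fromℕ zero    = 0#
  fromℕ (suc n) = 1# + fromℕ n

  PSet : Set₁
  PSet = Point → Set

  IsFinite : PSet → Set
  IsFinite S = Σ (List Point) λ xs → ∀ x → (S x ⇔ (x ∈ xs))

  FinSet : Set₁
  FinSet = Σ PSet IsFinite

  _⊆_ : FinSet → FinSet → Set
  (A , _) ⊆ (B , _) = ∀ x → A x → B x

  Disjoint : FinSet → FinSet → Set
  Disjoint (A , _) (B , _) = ∀ x → A x → B x → ⊥

  _·_ : Carrier → Point → Point
  c · v = map (c *_) v

  _⊕_ : Point → Point → Point
  _⊕_ = zipWith _+_

  weightSum : List (Carrier × Point) → Carrier
  weightSum []             = 0#
  weightSum ((c , _) ∷ ws) = c + weightSum ws

  combination : List (Carrier × Point) → Point
  combination []             = replicate d 0#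
  combination ((c , x) ∷ ws) = (c · x) ⊕ combination ws

  data AllValid (A : PSet) : List (Carrier × Point) → Set where
    []  : AllValid A []
    _∷_ : ∀ {c x ws} → (0# ≤ c) × A x → AllValid A ws → AllValid A ((c , x) ∷ ws)

  InConv : FinSet → Point → Set
  InConv (A , _) q =
    Σ (List (Carrier × Point)) λ ws →
      AllValid A ws × (weightSum ws ≡ 1#) × (combination ws ≡ q)

  DepthMeasure : Set₁
  DepthMeasure = FinSet → Point → Carrier

  NonNegative : DepthMeasure → Set₁
  NonNegative ϱ = ∀ S q → 0# ≤ ϱ S q

  NonTrivial : DepthMeasure → Set₁
  NonTrivial ϱ = ∀ S q → InConv S q → 1# ≤ ϱ S q

  SuperAdditive : DepthMeasure → Set₁
  SuperAdditive ϱ = ∀ S S₁ S₂ q → S₁ ⊆ S → S₂ ⊆ S → Disjoint S₁ S₂ →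
                    ϱ S₁ q + ϱ S₂ q ≤ ϱ S q

  PartitionAt : FinSet → Point → ℕ → Set₁
  PartitionAt (S , _) q r =
    Σ (Fin r → FinSet) λ P →
      (∀ i j → ¬ (i ≡ j) → Disjoint (P i) (P j)) ×
      (∀ x → (S x ⇔ (Σ (Fin r) λ i → Data.Product.proj₁ (P i) x))) ×
      (∀ i → InConv (P i) q)

  IsTvD : FinSet → Point → ℕ → Set₁
  IsTvD S q t =
    (PartitionAt S q t × (∀ r → PartitionAt S q r → r Data.Nat.≤ t))
    ⊎ ((t ≡ 0) × (∀ r → ¬ PartitionAt S q r))

-- A Tverberg partition of S into t parts around q is split up one part at a
-- time: by super-additivity the depth of the union of the parts is at least
-- the sum of the depths of the parts, each of which is at least 1 by
-- non-triviality.  The union of the parts is S, and super-additivity together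
-- with non-negativity makes ϱ monotone, so t ≤ ϱ(S, q).  If there is no
-- partition at all, t = 0 and non-negativity suffices.
module Submission where

open import Defs
open import Data.Nat using (ℕ; zero; suc)
open import Data.Fin using (Fin; zero; suc)
open import Data.Fin.Properties using (suc-injective)
open import Data.List using (List; []; _++_)
open import Data.List.Membership.Propositional using (_∈_)
open import Data.List.Membership.Propositional.Properties using (∈-++⁺ˡ; ∈-++⁺ʳ; ∈-++⁻)
open import Data.Product using (Σ; _,_; proj₁; proj₂)
open import Data.Sum using (inj₁; inj₂)
open import Data.Empty using (⊥)
open import Relation.Nullary using (¬_)
open import Relation.Binary.PropositionalEquality using (_≡_; refl; subst)
open import Relation.Binary.Structures using (IsTotalOrder)
open import Function using (_∘_)
open import Function.Bundles using (_⇔_; mk⇔; Equivalence)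
import Algebra.Structures as AS

module OrderedFieldProperties (𝔽 : OrderedField) where
  open OrderedField 𝔽
  open AS.IsCommutativeRing isCommutativeRing using (+-comm; +-identityʳ)
  open IsTotalOrder isTotalOrder using () renaming (trans to ≤-trans; refl to ≤-refl)

  +-mono-≤₂ : ∀ {a b c e} → a ≤ b → c ≤ e → a + c ≤ b + e
  +-mono-≤₂ {a} {b} {c} {e} a≤b c≤e =
    ≤-trans (+-mono-≤ c a≤b)
      (subst (_≤ b + e) (+-comm c b) (subst (c + b ≤_) (+-comm e b) (+-mono-≤ b c≤e)))

  x≤x+nonneg : ∀ {x y} → 0# ≤ y → x ≤ x + y
  x≤x+nonneg {x} 0≤y = subst (_≤ x + _) (+-identityʳ x) (+-mono-≤₂ ≤-refl 0≤y)

module FiniteSets (𝔽 : OrderedField) (d : ℕ) where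

  ∅ : FinSet 𝔽 d
  ∅ = (λ _ → ⊥) , [] , λ _ → mk⇔ (λ ()) (λ ())

  ⋃-pred : (r : ℕ) → (Fin r → FinSet 𝔽 d) → PSet 𝔽 d
  ⋃-pred r P x = Σ (Fin r) λ i → proj₁ (P i) x

  ⋃-list : (r : ℕ) → (Fin r → FinSet 𝔽 d) → List (Point 𝔽 d)
  ⋃-list zero    P = []
  ⋃-list (suc r) P = proj₁ (proj₂ (P zero)) ++ ⋃-list r (P ∘ suc)

  ⋃-list-complete : ∀ r (P : Fin r → FinSet 𝔽 d) x → ⋃-pred r P x ⇔ (x ∈ ⋃-list r P)
  ⋃-list-complete zero    P x = mk⇔ (λ ()) (λ ())
  ⋃-list-complete (suc r) P x = mk⇔ to from
    where
    P₀-list = proj₁ (proj₂ (P zero))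
    P₀-complete = proj₂ (proj₂ (P zero)) x
    rest = ⋃-list-complete r (P ∘ suc) x

    to : ⋃-pred (suc r) P x → x ∈ ⋃-list (suc r) P
    to (zero  , x∈P₀) = ∈-++⁺ˡ (Equivalence.to P₀-complete x∈P₀)
    to (suc i , x∈Pᵢ) = ∈-++⁺ʳ P₀-list (Equivalence.to rest (i , x∈Pᵢ))

    from : x ∈ ⋃-list (suc r) P → ⋃-pred (suc r) P x
    from x∈ with ∈-++⁻ P₀-list x∈
    ... | inj₁ x∈P₀ = zero , Equivalence.from P₀-complete x∈P₀
    ... | inj₂ x∈rest with Equivalence.from rest x∈rest
    ...   | i , x∈Pᵢ = suc i , x∈Pᵢ

  ⋃ : (r : ℕ) → (Fin r → FinSet 𝔽 d) → FinSet 𝔽 d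
  ⋃ r P = ⋃-pred r P , ⋃-list r P , ⋃-list-complete r P

  PairwiseDisjoint : ∀ {r} → (Fin r → FinSet 𝔽 d) → Set
  PairwiseDisjoint P = ∀ i j → ¬ i ≡ j → Disjoint 𝔽 d (P i) (P j)

module DepthMeasureProperties
    (𝔽 : OrderedField) (d : ℕ) (ϱ : DepthMeasure 𝔽 d)
    (nonneg : NonNegative 𝔽 d ϱ) (superadd : SuperAdditive 𝔽 d ϱ) where
  open OrderedField 𝔽
  open IsTotalOrder isTotalOrder using () renaming (trans to ≤-trans)
  open OrderedFieldProperties 𝔽
  open FiniteSets 𝔽 d

  ϱ-mono : ∀ {T S} q → _⊆_ 𝔽 d T S → ϱ T q ≤ ϱ S q
  ϱ-mono {T} {S} q T⊆S =
    ≤-trans (x≤x+nonneg (nonneg ∅ q))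
            (superadd S T ∅ q T⊆S (λ _ ()) (λ _ _ ()))

  ⋃-depth : (nontriv : NonTrivial 𝔽 d ϱ) (q : Point 𝔽 d) →
            ∀ r (P : Fin r → FinSet 𝔽 d) → PairwiseDisjoint P →
            (∀ i → InConv 𝔽 d (P i) q) → fromℕ 𝔽 d r ≤ ϱ (⋃ r P) q
  ⋃-depth nontriv q zero    P disj q∈P = nonneg (⋃ zero P) q
  ⋃-depth nontriv q (suc r) P disj q∈P =
    ≤-trans (+-mono-≤₂ (nontriv (P zero) q (q∈P zero))
                       (⋃-depth nontriv q r (P ∘ suc) disj-rest (q∈P ∘ suc)))
            (superadd (⋃ (suc r) P) (P zero) (⋃ r (P ∘ suc)) q
                      (λ _ x∈P₀ → zero , x∈P₀)
                      (λ { _ (i , x∈Pᵢ) → suc i , x∈Pᵢ })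
                      (λ { x x∈P₀ (i , x∈Pᵢ) → disj zero (suc i) (λ ()) x x∈P₀ x∈Pᵢ }))
    where
    disj-rest : PairwiseDisjoint (P ∘ suc)
    disj-rest i j i≢j = disj (suc i) (suc j) (i≢j ∘ suc-injective)

mainTheorem6 : (𝔽 : OrderedField) (d : ℕ) (ϱ : DepthMeasure 𝔽 d) →
               NonNegative 𝔽 d ϱ → NonTrivial 𝔽 d ϱ → SuperAdditive 𝔽 d ϱ →
               ∀ (S : FinSet 𝔽 d) (q : Point 𝔽 d) (t : ℕ) → IsTvD 𝔽 d S q t →
               OrderedField._≤_ 𝔽 (fromℕ 𝔽 d t) (ϱ S q)
mainTheorem6 𝔽 d ϱ nonneg nontriv superadd S q t (inj₂ (refl , _)) = nonneg S q
mainTheorem6 𝔽 d ϱ nonneg nontriv superadd S q t (inj₁ ((P , disj , covers , q∈P) , _)) =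
  ≤-trans (⋃-depth nontriv q t P disj q∈P)
          (ϱ-mono q (λ x x∈⋃ → Equivalence.from (covers x) x∈⋃))
  where
  open IsTotalOrder (OrderedField.isTotalOrder 𝔽) using () renaming (trans to ≤-trans)
  open DepthMeasureProperties 𝔽 d ϱ nonneg superadd
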